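{- If $n$ and $a$ are integers such that $3\le a\le\left\lfloor\frac{n}{2}\right\rfloor$ and $n>3a$, then $C(n;1,a)$ admits a $2$-bounded $\beta_b$-broadcast.
   Context: For integers $n\ge 3$ and $1\le a\le\lfloor n/2\rfloor$, the circulant graph $C(n;1,a)$ has vertex set $\{v_0,\dots,v_{n-1}\}$ and edges $v_iv_{i+1}$ and $v_iv_{i+a}$, subscripts modulo $n$. For a connected graph $G$, a broadcast is a function $f:V(G)\to\{0,\dots,\mathrm{diam}(G)\}$ with $f(v)\le e(v)$ (eccentricity) for all $v$; $V_f^+=\{v:f(v)>0\}$. $f$ is independent if $d(u,v)>\max\{f(u),f(v)\}$ for all distinct $u,v\in V_f^+$. The cost is $\sigma(f)=\sum_v f(v)$; $\beta_b(G)$ is the maximum cost of an independent broadcast on $G$, and a $\beta_b$-broadcast is an independent broadcast of cost $\beta_b(G)$. An independent broadcast is $2$-bounded if $f(v)\le 2$ for every vertex $v$. -}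

module Defs where

open import Data.Nat using (ℕ; zero; suc; _+_; _≤_; _<_; _⊔_; _/_)
open import Data.Fin using (Fin; toℕ)
open import Data.List using (map; allFin)
open import Data.Nat.ListAction using (sum)
open import Data.Product using (Σ; ∃; _×_; _,_)
open import Data.Sum using (_⊎_)
open import Relation.Binary.PropositionalEquality using (_≡_; _≢_)
open import Relation.Nullary using (¬_)

-- Vertices of C(n;1,a) are Fin n (v_i ↦ i).
-- v_j = v_{i+s mod n}, for 0 ≤ i,j < n and 0 < s < n.
StepBy : (n s : ℕ) → Fin n → Fin n → Set
StepBy n s u v = (toℕ u + s ≡ toℕ v) ⊎ (toℕ u + s ≡ toℕ v + n)

Adj : (n a : ℕ) → Fin n → Fin n → Set
Adj n a u v = StepBy n 1 u v ⊎ StepBy n 1 v u ⊎ StepBy n a u v ⊎ StepBy n a v u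

data Walk (n a : ℕ) : Fin n → Fin n → ℕ → Set where
  here : ∀ {u} → Walk n a u u 0
  step : ∀ {u w v k} → Adj n a u w → Walk n a w v k → Walk n a u v (suc k)

DistLe : (n a : ℕ) → Fin n → Fin n → ℕ → Set
DistLe n a u v k = ∃ λ j → j ≤ k × Walk n a u v j

cost : {n : ℕ} → (Fin n → ℕ) → ℕ
cost {n} f = sum (map f (allFin n))

-- f is a broadcast: f(v) ≤ e(v), i.e. some w has d(v,w) ≥ f(v)
-- (this also gives f(v) ≤ diam).
IsBroadcast : (n a : ℕ) → (Fin n → ℕ) → Set
IsBroadcast n a f = ∀ v → ∃ λ w → ∀ k → k < f v → ¬ DistLe n a v w k

IsIndependent : (n a : ℕ) → (Fin n → ℕ) → Set
IsIndependent n a f =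
  ∀ u v → u ≢ v → 0 < f u → 0 < f v → ¬ DistLe n a u v (f u ⊔ f v)

IsIndepBroadcast : (n a : ℕ) → (Fin n → ℕ) → Set
IsIndepBroadcast n a f = IsBroadcast n a f × IsIndependent n a f

IsBetaBroadcast : (n a : ℕ) → (Fin n → ℕ) → Set
IsBetaBroadcast n a f =
  IsIndepBroadcast n a f × (∀ g → IsIndepBroadcast n a g → cost g ≤ cost f)

TwoBounded : {n : ℕ} → (Fin n → ℕ) → Set
TwoBounded f = ∀ v → f v ≤ 2

-- Let g be an independent broadcast. Every vertex v with g v = k ≥ 3 is replaced by a packing:
-- 2r + 2 ≥ k pairwise non-adjacent vertices within distance r of v, where 2r + 1 ≤ k ≤ 2r + 2,
-- each broadcasting 1; vertices with g v ≤ 2 keep their value. Two broadcasting vertices of g are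
-- at distance > max(g u, g v) ≥ r_u + 1 + r_v, so the new broadcast h is again independent; it is
-- 2-bounded and, since each v loses g v ≤ 2r + 2 and gains 2r + 2, cost g ≤ cost h. The packings
-- are explicit sets of offsets v + t, no two differing by 0, ±1 or ±a (one construction for
-- 2r < a, one for a ≤ 2r); they fit in the graph because 3a < n and because g v is bounded by the
-- eccentricity of v, hence by the diameter (2a·g v < n + a²). So a 2-bounded independent broadcast
-- of maximum cost, found among the finitely many 2-bounded functions, is a β_b-broadcast.

module Submission where

open import Defs
open import Data.Bool using (if_then_else_)
open import Data.Empty using (⊥; ⊥-elim)
open import Data.Fin using (Fin; zero; suc; toℕ; fromℕ<; splitAt; join)
import Data.Fin.Properties as Fin
open import Data.Fin.Properties using (toℕ≤pred[n])
open import Data.List using (List; tabulate; map; _∷_; []; _++_; filter)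
open import Data.List.Extrema.Nat using (argmax; argmax-all; f[xs]≤f[argmax])
open import Data.List.Membership.Propositional using (find)
open import Data.List.Membership.Propositional.Properties using (∈-filter⁺)
import Data.List.Properties as List
import Data.List.Relation.Unary.All as All
open import Data.List.Relation.Unary.All.Properties using (all-filter)
open import Data.List.Relation.Unary.Any using (Any; here)
import Data.List.Relation.Unary.Any.Properties as Any
open import Data.Nat
open import Data.Nat.DivMod
import Data.Nat.ListAction as List
open import Data.Nat.Properties
open import Algebra.Properties.CommutativeMonoid.Sum +-0-commutativeMonoid
  using (sum; sum-cong-≗; ∑-distrib-+; ∑-comm)
open import Data.Nat.Tactic.RingSolver using (solve-∀; solve)
open import Data.Product using (∃; _×_; _,_; proj₁; proj₂; map₂)
open import Data.Sum using (_⊎_; inj₁; inj₂; [_,_]′)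
import Data.Sum as Sum
import Data.Sum.Properties as Sum
import Data.Vec.Functional as Vector
open import Function using (_∘_; id)
open import Relation.Binary.PropositionalEquality
open import Relation.Nullary using (¬_; Dec; does; yes; no; contradiction)
open import Relation.Nullary.Decidable using (map′; ¬?; _×-dec_; _⊎-dec_; _→-dec_)

sum-tabulate : ∀ {n} (f : Fin n → ℕ) → List.sum (tabulate f) ≡ sum f
sum-tabulate {zero} f = refl
sum-tabulate {suc n} f = cong (f zero +_) (sum-tabulate (f ∘ suc))

cost≡sum : ∀ {n} (f : Fin n → ℕ) → cost f ≡ sum f
cost≡sum f = trans (cong List.sum (List.map-tabulate id f)) (sum-tabulate f)

sum-mono-≤ : ∀ {n} {f g : Fin n → ℕ} → (∀ i → f i ≤ g i) → sum f ≤ sum g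
sum-mono-≤ {zero} f≤g = z≤n
sum-mono-≤ {suc n} f≤g = +-mono-≤ (f≤g zero) (sum-mono-≤ (f≤g ∘ suc))

sum-zero : ∀ n → sum {n} (λ _ → 0) ≡ 0
sum-zero zero = refl
sum-zero (suc n) = sum-zero n

sum-one : ∀ n → sum {n} (λ _ → 1) ≡ n
sum-one zero = refl
sum-one (suc n) = cong suc (sum-one n)

sum-positive : ∀ {n} (f : Fin n → ℕ) → 0 < sum f → ∃ λ i → 0 < f i
sum-positive {suc n} f 0<Σ with f zero in eq
... | suc _ = zero , subst (0 <_) (sym eq) (s≤s z≤n)
... | zero with sum-positive (f ∘ suc) 0<Σ
...   | i , 0<fi = suc i , 0<fi

sum-≤1 : ∀ {n} (f : Fin n → ℕ) → (∀ i → f i ≤ 1) →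
         (∀ i j → 0 < f i → 0 < f j → i ≡ j) → sum f ≤ 1
sum-≤1 {zero} f f≤1 unique = z≤n
sum-≤1 {suc n} f f≤1 unique with f zero in eq
... | zero = sum-≤1 (f ∘ suc) (f≤1 ∘ suc)
               (λ i j p q → Fin.suc-injective (unique (suc i) (suc j) p q))
... | suc k = begin
  suc k + sum (f ∘ suc) ≡⟨ cong (suc k +_) (trans (sum-cong-≗ rest≡0) (sum-zero n)) ⟩
  suc k + 0             ≡⟨ +-identityʳ (suc k) ⟩
  suc k                 ≡⟨ eq ⟨
  f zero                ≤⟨ f≤1 zero ⟩
  1                     ∎
  where
  open ≤-Reasoning
  rest≡0 : ∀ i → f (suc i) ≡ 0
  rest≡0 i with f (suc i) in eqi
  ... | zero = refl
  ... | suc _ with unique zero (suc i) (subst (0 <_) (sym eq) (s≤s z≤n))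
                                       (subst (0 <_) (sym eqi) (s≤s z≤n))
  ...   | ()

δ : ∀ {n} → Fin n → Fin n → ℕ
δ x y = if does (x Fin.≟ y) then 1 else 0

δ≤1 : ∀ {n} (x y : Fin n) → δ x y ≤ 1
δ≤1 x y with x Fin.≟ y
... | yes _ = ≤-refl
... | no _ = z≤n

δ-positive : ∀ {n} (x y : Fin n) → 0 < δ x y → x ≡ y
δ-positive x y 0<δ with x Fin.≟ y
... | yes x≡y = x≡y

sum-δ : ∀ {n} (y : Fin n) → sum (λ x → δ x y) ≡ 1
sum-δ {suc n} zero = cong suc (sum-zero n)
sum-δ (suc y) = sum-δ y

cost-cong : ∀ {n} {f g : Fin n → ℕ} → f ≗ g → cost f ≡ cost g
cost-cong {f = f} {g} f≗g = trans (cost≡sum f) (trans (sum-cong-≗ f≗g) (sym (cost≡sum g)))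

≤-by-excess : ∀ {x y} k → x + k ≡ y → x ≤ y
≤-by-excess {x} k refl = m≤m+n x k

parity-clash : ∀ {x y} → x ≡ y → ∀ c m k → x ≡ c + 2 * m → y ≡ c + suc (2 * k) → ⊥
parity-clash refl c m k e₁ e₂ = even≢odd m k (+-cancelˡ-≡ c _ _ (trans (sym e₁) e₂))

excess-clash : ∀ {x y} → x ≡ y → ∀ c k → x ≡ c + suc k → y ≡ c → ⊥
excess-clash refl c k e₁ e₂ = m+1+n≢m c (trans (sym e₁) e₂)

3*x≡2*x+x : ∀ x → 3 * x ≡ 2 * x + x
3*x≡2*x+x = solve-∀

half-complement : ∀ {n y} → y ≤ n → ¬ 2 * y ≤ n → 2 * (n ∸ y) ≤ n
half-complement {n} {y} y≤n 2y≰n = +-cancelʳ-≤ (2 * y) _ _ (begin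
  2 * (n ∸ y) + 2 * y ≡⟨ *-distribˡ-+ 2 (n ∸ y) y ⟨
  2 * (n ∸ y + y)     ≡⟨ cong (2 *_) (m∸n+n≡m y≤n) ⟩
  n + (n + 0)         ≡⟨ cong (n +_) (+-identityʳ n) ⟩
  n + n               ≤⟨ +-monoʳ-≤ n (<⇒≤ (≰⇒> 2y≰n)) ⟩
  n + 2 * y           ∎)
  where open ≤-Reasoning

digits-bound : ∀ {a n y} q s → y ≡ s + q * a → 2 * y ≤ n → 2 * s ≤ a → 1 ≤ a →
               2 * a * (q + s) < n + a * a
digits-bound {a} {n} q zero refl 2y≤n _ 1≤a = begin-strict
  2 * a * (q + 0) ≡⟨ identity a q ⟩
  2 * (0 + q * a) ≤⟨ 2y≤n ⟩
  n               <⟨ m<m+n n (*-mono-≤ 1≤a 1≤a) ⟩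
  n + a * a       ∎
  where
  open ≤-Reasoning
  identity : ∀ a q → 2 * a * (q + 0) ≡ 2 * (0 + q * a)
  identity = solve-∀
digits-bound {a} {n} q s@(suc _) refl 2y≤n 2s≤a _ = begin-strict
  2 * a * (q + s)         <⟨ m<m+n _ (s≤s z≤n) ⟩
  2 * a * (q + s) + 2 * s ≡⟨ identity a q s ⟩
  2 * (s + q * a) + 2 * s * a ≤⟨ +-mono-≤ 2y≤n (*-monoˡ-≤ a 2s≤a) ⟩
  n + a * a               ∎
  where
  open ≤-Reasoning
  identity : ∀ a q s → 2 * a * (q + s) + 2 * s ≡ 2 * (s + q * a) + 2 * s * a
  identity = solve-∀

overshoot-bound : ∀ {a n y} q t → y + t ≡ suc q * a → 2 * y ≤ n → 2 * t < a →
                  2 * a * (suc q + t) < n + a * a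
overshoot-bound {a} {n} {y} q t y+t≡ 2y≤n 2t<a = begin-strict
  2 * a * (suc q + t)         ≡⟨ identity a q t ⟩
  2 * (suc q * a) + 2 * t * a ≡⟨ cong (λ x → 2 * x + 2 * t * a) y+t≡ ⟨
  2 * (y + t) + 2 * t * a     ≡⟨ identity′ y t a ⟩
  2 * y + (2 * t + 2 * t * a) <⟨ +-mono-≤-< 2y≤n (+-monoˡ-< (2 * t * a) 2t<a) ⟩
  n + (a + 2 * t * a)         ≤⟨ +-monoʳ-≤ n (*-monoˡ-≤ a 2t<a) ⟩
  n + a * a                   ∎
  where
  open ≤-Reasoning
  identity : ∀ a q t → 2 * a * (suc q + t) ≡ 2 * (suc q * a) + 2 * t * a
  identity = solve-∀
  identity′ : ∀ y t a → 2 * (y + t) + 2 * t * a ≡ 2 * y + (2 * t + 2 * t * a)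
  identity′ = solve-∀

radius-of : ∀ k → 3 ≤ k → ∃ λ r → 1 ≤ r × r + r + 1 ≤ k × k ≤ r + r + 2
radius-of 1 (s≤s ())
radius-of 2 (s≤s (s≤s ()))
radius-of 3 _ = 1 , ≤-refl , ≤-refl , n≤1+n 3
radius-of 4 _ = 1 , ≤-refl , n≤1+n 3 , ≤-refl
radius-of (suc (suc k@(suc (suc (suc _))))) _ with radius-of k (s≤s (s≤s (s≤s z≤n)))
... | r , _ , lower , upper = suc r , s≤s z≤n ,
  ≤-trans (≤-reflexive (shift r 1)) (s≤s (s≤s lower)) ,
  ≤-trans (s≤s (s≤s upper)) (≤-reflexive (sym (shift r 2)))
  where
  shift : ∀ r c → suc r + suc r + c ≡ 2 + (r + r + c)
  shift = solve-∀

window-from-eccentricity : ∀ {a n k r} → 2 * a * k < n + a * a → a ≤ r + r → r + r + 1 ≤ k →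
                           2 * a * r + a < n
window-from-eccentricity {a} {n} {k} {r} 2ak<n+aa a≤2r 2r+1≤k = begin-strict
  2 * a * r + a     ≡⟨ solve (a ∷ r ∷ []) ⟩
  a * (r + r + 1)   ≤⟨ *-monoʳ-≤ a 2r+1≤k ⟩
  a * k             ≤⟨ m≤m+n (a * k) a ⟩
  a * k + a         <⟨ ak+a<n ⟩
  n                 ∎
  where
  open ≤-Reasoning
  ak+a<n : a * k + a < n
  ak+a<n = +-cancelʳ-< (a * a) (a * k + a) n (begin-strict
    a * k + a + a * a       ≡⟨ solve (a ∷ k ∷ []) ⟩
    a * k + a * (a + 1)     ≤⟨ +-monoʳ-≤ (a * k) (*-monoʳ-≤ a (≤-trans (+-monoˡ-≤ 1 a≤2r) 2r+1≤k)) ⟩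
    a * k + a * k           ≡⟨ solve (a ∷ k ∷ []) ⟩
    2 * a * k               <⟨ 2ak<n+aa ⟩
    n + a * a               ∎)

radius-mono : ∀ {r₁ r₂ k₁ k₂} → r₂ + r₂ + 1 ≤ k₂ → k₂ ≤ k₁ → k₁ ≤ r₁ + r₁ + 2 → r₂ ≤ r₁
radius-mono {r₁} {r₂} lower₂ k₂≤k₁ upper₁ = ≮⇒≥ λ r₁<r₂ → <⇒≱ (begin-strict
  r₁ + r₁ + 2     ≡⟨ solve (r₁ ∷ []) ⟩
  suc r₁ + suc r₁ ≤⟨ +-mono-≤ r₁<r₂ r₁<r₂ ⟩
  r₂ + r₂         <⟨ m<m+n (r₂ + r₂) (s≤s z≤n) ⟩
  r₂ + r₂ + 1     ∎) (≤-trans lower₂ (≤-trans k₂≤k₁ upper₁))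
  where open ≤-Reasoning

radii-within-max : ∀ {r₁ r₂ k₁ k₂} → r₁ + r₁ + 1 ≤ k₁ → k₁ ≤ r₁ + r₁ + 2 →
                   r₂ + r₂ + 1 ≤ k₂ → k₂ ≤ r₂ + r₂ + 2 → r₁ + 1 + r₂ ≤ k₁ ⊔ k₂
radii-within-max {r₁} {r₂} {k₁} {k₂} lower₁ upper₁ lower₂ upper₂ with ≤-total k₂ k₁
... | inj₁ k₂≤k₁ = ≤-trans (begin
  r₁ + 1 + r₂ ≤⟨ +-monoʳ-≤ (r₁ + 1) (radius-mono lower₂ k₂≤k₁ upper₁) ⟩
  r₁ + 1 + r₁ ≡⟨ solve (r₁ ∷ []) ⟩
  r₁ + r₁ + 1 ≤⟨ lower₁ ⟩
  k₁          ∎) (m≤m⊔n k₁ k₂)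
  where open ≤-Reasoning
... | inj₂ k₁≤k₂ = ≤-trans (begin
  r₁ + 1 + r₂ ≤⟨ +-monoˡ-≤ r₂ (+-monoˡ-≤ 1 (radius-mono lower₁ k₁≤k₂ upper₂)) ⟩
  r₂ + 1 + r₂ ≡⟨ solve (r₂ ∷ []) ⟩
  r₂ + r₂ + 1 ≤⟨ lower₂ ⟩
  k₂          ∎) (m≤n⊔m k₁ k₂)
  where open ≤-Reasoning

radius+2≤ : ∀ {r k} → 3 ≤ k → r + r + 1 ≤ k → k ≤ r + r + 2 → r + 2 ≤ k
radius+2≤ {zero} 3≤k _ k≤2 = ⊥-elim (<⇒≱ 3≤k k≤2)
radius+2≤ {suc r} _ lower _ = ≤-trans (≤-by-excess {suc r + 2} {suc r + suc r + 1} r (solve (r ∷ []))) lower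

module _ {n a : ℕ} where

  Adj-sym : ∀ {u v} → Adj n a u v → Adj n a v u
  Adj-sym (inj₁ e) = inj₂ (inj₁ e)
  Adj-sym (inj₂ (inj₁ e)) = inj₁ e
  Adj-sym (inj₂ (inj₂ (inj₁ e))) = inj₂ (inj₂ (inj₂ e))
  Adj-sym (inj₂ (inj₂ (inj₂ e))) = inj₂ (inj₂ (inj₁ e))

  walk-++ : ∀ {u v w j k} → Walk n a u v j → Walk n a v w k → Walk n a u w (j + k)
  walk-++ here q = q
  walk-++ (step e p) q = step e (walk-++ p q)

  walk-reverse : ∀ {u v j} → Walk n a u v j → Walk n a v u j
  walk-reverse here = here
  walk-reverse {j = suc j} (step e p) =
    subst (Walk n a _ _) (+-comm j 1) (walk-++ (walk-reverse p) (step (Adj-sym e) here))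

  DistLe-refl : ∀ {u} → DistLe n a u u 0
  DistLe-refl = 0 , z≤n , here

  DistLe-sym : ∀ {u v k} → DistLe n a u v k → DistLe n a v u k
  DistLe-sym (j , j≤k , p) = j , j≤k , walk-reverse p

  DistLe-trans : ∀ {u v w j k} → DistLe n a u v j → DistLe n a v w k → DistLe n a u w (j + k)
  DistLe-trans (j₁ , l₁ , p) (j₂ , l₂ , q) = j₁ + j₂ , +-mono-≤ l₁ l₂ , walk-++ p q

  DistLe-mono : ∀ {u v j k} → j ≤ k → DistLe n a u v j → DistLe n a u v k
  DistLe-mono j≤k (i , i≤j , p) = i , ≤-trans i≤j j≤k , p

  ≡⇒DistLe : ∀ {u v} → u ≡ v → ∀ k → DistLe n a u v k
  ≡⇒DistLe refl k = DistLe-mono z≤n DistLe-refl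

  Adj⇒DistLe : ∀ {u v} → Adj n a u v → DistLe n a u v 1
  Adj⇒DistLe e = 1 , ≤-refl , step e here

  DistLe0⇒≡ : ∀ {u v} → DistLe n a u v 0 → u ≡ v
  DistLe0⇒≡ (.0 , z≤n , here) = refl

  DistLe1⇒≡⊎Adj : ∀ {u v} → DistLe n a u v 1 → u ≡ v ⊎ Adj n a u v
  DistLe1⇒≡⊎Adj (.0 , _ , here) = inj₁ refl
  DistLe1⇒≡⊎Adj (.1 , _ , step e here) = inj₂ e
  DistLe1⇒≡⊎Adj (.(suc (suc _)) , s≤s () , step _ (step _ _))

  DistLe-along : (f : ℕ → Fin n) → (∀ i → DistLe n a (f i) (f (suc i)) 1) →
                 ∀ u e → DistLe n a (f u) (f (u + e)) e
  DistLe-along f f-step u zero = subst (λ i → DistLe n a (f u) (f i) 0) (sym (+-identityʳ u)) DistLe-refl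
  DistLe-along f f-step u (suc e) = subst (λ i → DistLe n a (f u) (f i) (suc e)) (sym (+-suc u e))
    (DistLe-trans (f-step u) (DistLe-along f f-step (suc u) e))

  DistLe-along-≤ : (f : ℕ → Fin n) → (∀ i → DistLe n a (f i) (f (suc i)) 1) →
                   ∀ {u w d} → u ≤ w + d → w ≤ u + d → DistLe n a (f u) (f w) d
  DistLe-along-≤ f f-step {u} {w} {d} u≤w+d w≤u+d with ≤-total u w
  ... | inj₁ u≤w = subst (λ i → DistLe n a (f u) (f i) d) (m+[n∸m]≡n u≤w)
    (DistLe-mono (m≤n+o⇒m∸n≤o w u w≤u+d) (DistLe-along f f-step u (w ∸ u)))
  ... | inj₂ w≤u = DistLe-sym (subst (λ i → DistLe n a (f w) (f i) d) (m+[n∸m]≡n w≤u)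
    (DistLe-mono (m≤n+o⇒m∸n≤o u w u≤w+d) (DistLe-along f f-step w (u ∸ w))))

-- Offsets t₁, t₂ whose vertices v_{b+t₁}, v_{b+t₂} coincide or are adjacent, absent wrap-around.
data Near (a t₁ t₂ : ℕ) : Set where
  equal : t₁ ≡ t₂ → Near a t₁ t₂
  up1   : t₁ + 1 ≡ t₂ → Near a t₁ t₂
  down1 : t₂ + 1 ≡ t₁ → Near a t₁ t₂
  upA   : t₁ + a ≡ t₂ → Near a t₁ t₂
  downA : t₂ + a ≡ t₁ → Near a t₁ t₂

Near-sym : ∀ {a t₁ t₂} → Near a t₁ t₂ → Near a t₂ t₁
Near-sym (equal e) = equal (sym e)
Near-sym (up1 e) = down1 e
Near-sym (down1 e) = up1 e
Near-sym (upA e) = downA e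
Near-sym (downA e) = upA e

Near-far : ∀ {a x y} → x + 2 ≤ y → Near a x y → x + a ≡ y
Near-far {x = x} x+2≤y (equal refl) = ⊥-elim (m+1+n≰m x x+2≤y)
Near-far {x = x} x+2≤y (up1 refl) = contradiction (+-cancelˡ-≤ x 2 1 x+2≤y) λ { (s≤s ()) }
Near-far {x = x} {y} x+2≤y (down1 refl) = ⊥-elim (m+1+n≰m y (subst (_≤ y) (+-assoc y 1 2) x+2≤y))
Near-far x+2≤y (upA e) = e
Near-far {a} {y = y} x+2≤y (downA refl) = ⊥-elim (m+1+n≰m y (≤-trans (+-monoˡ-≤ 2 (m≤m+n y a)) x+2≤y))

cancel-base : ∀ c {x y z} → c + x + y ≡ c + z → x + y ≡ z
cancel-base c {x} {y} e = +-cancelˡ-≡ c _ _ (trans (sym (+-assoc c x y)) e)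

even+1≢even : ∀ s p q → 2 * s * p + 1 ≢ 2 * s * q
even+1≢even s p q e = even≢odd (s * q) (s * p) (begin
  2 * (s * q)     ≡⟨ *-assoc 2 s q ⟨
  2 * s * q       ≡⟨ e ⟨
  2 * s * p + 1   ≡⟨ cong (_+ 1) (*-assoc 2 s p) ⟩
  2 * (s * p) + 1 ≡⟨ +-comm _ 1 ⟩
  suc (2 * (s * p)) ∎)
  where open ≡-Reasoning

Near-progression : ∀ {a} c s {p q} .{{_ : NonZero s}} →
  2 * s * p + a ≢ 2 * s * q → 2 * s * q + a ≢ 2 * s * p →
  Near a (c + 2 * s * p) (c + 2 * s * q) → p ≡ q
Near-progression c s {p} {q} _ _ (equal e) = *-cancelˡ-≡ p q (2 * s) {{m*n≢0 2 s}} (+-cancelˡ-≡ c _ _ e)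
Near-progression c s {p} {q} _ _ (up1 e) = ⊥-elim (even+1≢even s p q (cancel-base c e))
Near-progression c s {p} {q} _ _ (down1 e) = ⊥-elim (even+1≢even s q p (cancel-base c e))
Near-progression c s p+a≢q _ (upA e) = ⊥-elim (p+a≢q (cancel-base c e))
Near-progression c s _ q+a≢p (downA e) = ⊥-elim (q+a≢p (cancel-base c e))

x+a≢y<a : ∀ {a x y} → y < a → x + a ≢ y
x+a≢y<a {a} {x} y<a refl = m+n≮n x a y<a

Slot : ℕ → Set
Slot r = Fin (suc r) ⊎ Fin r ⊎ Fin 1

r+r+2≡slots : ∀ r → r + r + 2 ≡ suc r + (r + 1)
r+r+2≡slots = solve-∀

slot : ∀ r → Fin (suc r + (r + 1)) → Slot r
slot r = Sum.map₂ (splitAt r) ∘ splitAt (suc r)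

slot-injective : ∀ r {i j} → slot r i ≡ slot r j → i ≡ j
slot-injective r {i} {j} e = splitAt-injective (suc r) (map₂-injective (splitAt-injective r) e)
  where
  splitAt-injective : ∀ m {k} {x y : Fin (m + k)} → splitAt m x ≡ splitAt m y → x ≡ y
  splitAt-injective m {k} {x} {y} e =
    trans (sym (Fin.join-splitAt m k x)) (trans (cong (join m k) e) (Fin.join-splitAt m k y))
  map₂-injective : ∀ {A B C : Set} {g : B → C} → (∀ {x y} → g x ≡ g y → x ≡ y) →
                   ∀ {x y : A ⊎ B} → Sum.map₂ g x ≡ Sum.map₂ g y → x ≡ y
  map₂-injective g-inj {inj₁ x} {inj₁ .x} refl = refl
  map₂-injective g-inj {inj₂ x} {inj₂ y} e = cong inj₂ (g-inj (Sum.inj₂-injective e))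

record Packing (n a : ℕ) (v : Fin n) (k : ℕ) : Set where
  field
    radius : ℕ
    radius-lower : radius + radius + 1 ≤ k
    radius-upper : k ≤ radius + radius + 2
    point : Fin (suc radius + (radius + 1)) → Fin n
    point-near : ∀ j → DistLe n a v (point j) radius
    point-separated : ∀ i j → DistLe n a (point i) (point j) 1 → i ≡ j

-- The circulant graph

module Circulant (n a : ℕ) .{{_ : NonZero n}} where

  vertex : ℕ → Fin n
  vertex m = fromℕ< (m%n<n m n)

  toℕ-vertex : ∀ m → toℕ (vertex m) ≡ m % n
  toℕ-vertex m = Fin.toℕ-fromℕ< (m%n<n m n)

  vertex-toℕ : (u : Fin n) → vertex (toℕ u) ≡ u
  vertex-toℕ u = Fin.toℕ-injective (trans (toℕ-vertex (toℕ u)) (m<n⇒m%n≡m (Fin.toℕ<n u)))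

  vertex-+n : ∀ m → vertex (m + n) ≡ vertex m
  vertex-+n m = Fin.toℕ-injective
    (trans (toℕ-vertex (m + n)) (trans ([m+n]%n≡m%n m n) (sym (toℕ-vertex m))))

  [m+s]%n≡[m%n+s]%n : ∀ m s → (m + s) % n ≡ (m % n + s) % n
  [m+s]%n≡[m%n+s]%n m s = begin
    (m + s) % n               ≡⟨ %-distribˡ-+ m s n ⟩
    (m % n + s % n) % n       ≡⟨ cong (λ x → (x + s % n) % n) (m%n%n≡m%n m n) ⟨
    (m % n % n + s % n) % n   ≡⟨ %-distribˡ-+ (m % n) s n ⟨
    (m % n + s) % n           ∎
    where open ≡-Reasoning

  StepBy-vertex : ∀ m s → s ≤ n → StepBy n s (vertex m) (vertex (m + s))
  StepBy-vertex m s s≤n rewrite toℕ-vertex m | toℕ-vertex (m + s)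
                              | [m+s]%n≡[m%n+s]%n m s with m % n + s <? n
  ... | yes x+s<n = inj₁ (sym (m<n⇒m%n≡m x+s<n))
  ... | no x+s≮n = inj₂ (sym (begin
    (x + s) % n + n           ≡⟨ cong (λ y → y % n + n) (m∸n+n≡m n≤x+s) ⟨
    (x + s ∸ n + n) % n + n   ≡⟨ cong (_+ n) ([m+n]%n≡m%n (x + s ∸ n) n) ⟩
    (x + s ∸ n) % n + n       ≡⟨ cong (_+ n) (m<n⇒m%n≡m x+s∸n<n) ⟩
    x + s ∸ n + n             ≡⟨ m∸n+n≡m n≤x+s ⟩
    x + s                     ∎))
    where
    open ≡-Reasoning
    x : ℕ
    x = m % n
    n≤x+s : n ≤ x + s
    n≤x+s = ≮⇒≥ x+s≮n
    x+s∸n<n : x + s ∸ n < n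
    x+s∸n<n = +-cancelʳ-< _ _ n
      (subst (_< n + n) (sym (m∸n+n≡m n≤x+s)) (+-mono-<-≤ (m%n<n m n) s≤n))

  Adj-+1 : ∀ m → Adj n a (vertex m) (vertex (m + 1))
  Adj-+1 m = inj₁ (StepBy-vertex m 1 (>-nonZero⁻¹ n))

  Adj-+a : a ≤ n → ∀ m → Adj n a (vertex m) (vertex (m + a))
  Adj-+a a≤n m = inj₂ (inj₂ (inj₁ (StepBy-vertex m a a≤n)))

  DistLe-units : ∀ b {x y d} → x ≤ y + d → y ≤ x + d → DistLe n a (vertex (b + x)) (vertex (b + y)) d
  DistLe-units b = DistLe-along-≤ (λ i → vertex (b + i)) unit-step
    where
    unit-step : ∀ i → DistLe n a (vertex (b + i)) (vertex (b + suc i)) 1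
    unit-step i = subst (λ m → DistLe n a (vertex (b + i)) (vertex m) 1)
      (trans (+-comm (b + i) 1) (sym (+-suc b i))) (Adj⇒DistLe (Adj-+1 (b + i)))

  DistLe-multiples : a ≤ n → ∀ c {u w d} → u ≤ w + d → w ≤ u + d →
                     DistLe n a (vertex (c + u * a)) (vertex (c + w * a)) d
  DistLe-multiples a≤n c = DistLe-along-≤ (λ i → vertex (c + i * a)) a-step
    where
    a-step : ∀ i → DistLe n a (vertex (c + i * a)) (vertex (c + suc i * a)) 1
    a-step i = subst (λ m → DistLe n a (vertex (c + i * a)) (vertex m) 1)
      (trans (+-assoc c (i * a) a) (cong (c +_) (+-comm (i * a) a))) (Adj⇒DistLe (Adj-+a a≤n (c + i * a)))

  StepBy-vertex⁻¹ : ∀ {s m₁ m₂} → StepBy n s (vertex m₁) (vertex m₂) → (m₁ + s) % n ≡ m₂ % n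
  StepBy-vertex⁻¹ {s} {m₁} {m₂} m₁→m₂ = trans ([m+s]%n≡[m%n+s]%n m₁ s) (case m₁→m₂)
    where
    case : StepBy n s (vertex m₁) (vertex m₂) → (m₁ % n + s) % n ≡ m₂ % n
    case (inj₁ e) rewrite toℕ-vertex m₁ | toℕ-vertex m₂ | e = m%n%n≡m%n m₂ n
    case (inj₂ e) rewrite toℕ-vertex m₁ | toℕ-vertex m₂ | e =
      trans ([m+n]%n≡m%n (m₂ % n) n) (m%n%n≡m%n m₂ n)

  %-injective-window : ∀ {x y} → x % n ≡ y % n → x ≤ y → y < x + n → x ≡ y
  %-injective-window {x} {y} x≡y x≤y y<x+n = trans (m≡m%n+[m/n]*n x n)
    (trans (cong₂ _+_ x≡y (cong (_* n) same-quotient)) (sym (m≡m%n+[m/n]*n y n)))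
    where
    same-quotient : x / n ≡ y / n
    same-quotient with m≤n⇒m<n∨m≡n (/-monoˡ-≤ n x≤y)
    ... | inj₂ eq = eq
    ... | inj₁ lt = contradiction x+n≤y (<⇒≱ y<x+n)
      where
      open ≤-Reasoning
      x+n≤y : x + n ≤ y
      x+n≤y = begin
        x + n                   ≡⟨ cong (_+ n) (m≡m%n+[m/n]*n x n) ⟩
        x % n + x / n * n + n   ≡⟨ +-assoc (x % n) _ n ⟩
        x % n + (x / n * n + n) ≡⟨ cong (x % n +_) (+-comm (x / n * n) n) ⟩
        x % n + suc (x / n) * n ≤⟨ +-mono-≤ (≤-reflexive x≡y) (*-monoˡ-≤ n lt) ⟩
        y % n + y / n * n       ≡⟨ m≡m%n+[m/n]*n y n ⟨
        y                       ∎

  %-injective-interval : ∀ {b c x y} → c < n → b ≤ x → x ≤ b + c → b ≤ y → y ≤ b + c →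
                         x % n ≡ y % n → x ≡ y
  %-injective-interval {b} {c} {x} {y} c<n b≤x x≤b+c b≤y y≤b+c x≡y =
    [ (λ x≤y → %-injective-window x≡y x≤y (below b≤x y≤b+c))
    , (λ y≤x → sym (%-injective-window (sym x≡y) y≤x (below b≤y x≤b+c))) ]′ (≤-total x y)
    where
    below : ∀ {u v} → b ≤ u → v ≤ b + c → v < u + n
    below {u} {v} b≤u v≤b+c = begin-strict
      v     ≤⟨ v≤b+c ⟩
      b + c <⟨ +-monoʳ-< b c<n ⟩
      b + n ≤⟨ +-monoˡ-≤ n b≤u ⟩
      u + n ∎
      where open ≤-Reasoning

  vertex≡⇒%≡ : ∀ {m₁ m₂} → vertex m₁ ≡ vertex m₂ → m₁ % n ≡ m₂ % n
  vertex≡⇒%≡ {m₁} {m₂} eq = trans (sym (toℕ-vertex m₁)) (trans (cong toℕ eq) (toℕ-vertex m₂))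

  offset-shift-injective : ∀ b {M t₁ t₂ s} → M + a < n → t₁ ≤ M → t₂ ≤ M → s ≤ a →
                           (b + t₁ + s) % n ≡ (b + t₂) % n → t₁ + s ≡ t₂
  offset-shift-injective b {M} {t₁} {t₂} {s} M+a<n t₁≤M t₂≤M s≤a eq =
    +-cancelˡ-≡ b _ _ (trans (sym (+-assoc b t₁ s))
      (%-injective-interval M+a<n (≤-trans (m≤m+n b t₁) (m≤m+n (b + t₁) s))
        (≤-trans (≤-reflexive (+-assoc b t₁ s)) (+-monoʳ-≤ b (+-mono-≤ t₁≤M s≤a)))
        (m≤m+n b t₂) (+-monoʳ-≤ b (≤-trans t₂≤M (m≤m+n M a))) eq))

  DistLe1⇒Near : ∀ b {M t₁ t₂} → 1 ≤ a → M + a < n → t₁ ≤ M → t₂ ≤ M →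
                 DistLe n a (vertex (b + t₁)) (vertex (b + t₂)) 1 → Near a t₁ t₂
  DistLe1⇒Near b {M} 1≤a M+a<n t₁≤M t₂≤M d with DistLe1⇒≡⊎Adj d
  ... | inj₁ eq = equal (trans (sym (+-identityʳ _)) (offset-shift-injective b M+a<n t₁≤M t₂≤M z≤n
                  (trans (cong (_% n) (+-identityʳ _)) (vertex≡⇒%≡ eq))))
  ... | inj₂ (inj₁ st) = up1 (offset-shift-injective b M+a<n t₁≤M t₂≤M 1≤a (StepBy-vertex⁻¹ st))
  ... | inj₂ (inj₂ (inj₁ st)) = down1 (offset-shift-injective b M+a<n t₂≤M t₁≤M 1≤a (StepBy-vertex⁻¹ st))
  ... | inj₂ (inj₂ (inj₂ (inj₁ st))) =
    upA (offset-shift-injective b M+a<n t₁≤M t₂≤M ≤-refl (StepBy-vertex⁻¹ st))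
  ... | inj₂ (inj₂ (inj₂ (inj₂ st))) =
    downA (offset-shift-injective b M+a<n t₂≤M t₁≤M ≤-refl (StepBy-vertex⁻¹ st))

  module _ (a≤n : a ≤ n) where

    DistLe-from-units : ∀ b s → DistLe n a (vertex b) (vertex (b + s)) s
    DistLe-from-units b s = subst (λ x → DistLe n a (vertex x) (vertex (b + s)) s) (+-identityʳ b)
      (DistLe-units b {0} {s} z≤n ≤-refl)

    DistLe-from-multiples : ∀ b q → DistLe n a (vertex b) (vertex (b + q * a)) q
    DistLe-from-multiples b q = subst (λ x → DistLe n a (vertex x) (vertex (b + q * a)) q)
      (+-identityʳ b) (DistLe-multiples a≤n b {0} {q} z≤n ≤-refl)

    DistLe-digits : ∀ b q s → DistLe n a (vertex b) (vertex (b + (s + q * a))) (q + s)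
    DistLe-digits b q s = subst (λ x → DistLe n a (vertex b) (vertex x) (q + s))
      (trans (+-assoc b (q * a) s) (cong (b +_) (+-comm (q * a) s)))
      (DistLe-trans (DistLe-from-multiples b q) (DistLe-from-units (b + q * a) s))

    DistLe-digits-overshoot : ∀ b q s t → s + t ≡ a →
      DistLe n a (vertex b) (vertex (b + (s + q * a))) (suc q + t)
    DistLe-digits-overshoot b q s t s+t≡a = DistLe-trans
      (DistLe-from-multiples b (suc q))
      (DistLe-sym (subst (λ x → DistLe n a (vertex (b + (s + q * a))) (vertex x) t) overshoot
        (DistLe-from-units (b + (s + q * a)) t)))
      where
      overshoot : b + (s + q * a) + t ≡ b + suc q * a
      overshoot = begin
        b + (s + q * a) + t   ≡⟨ shuffle b s t (q * a) ⟩
        b + ((s + t) + q * a) ≡⟨ cong (λ x → b + (x + q * a)) s+t≡a ⟩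
        b + (a + q * a)       ∎
        where
        open ≡-Reasoning
        shuffle : ∀ b s t x → b + (s + x) + t ≡ b + ((s + t) + x)
        shuffle = solve-∀

    DistLe-half : .{{_ : NonZero a}} → ∀ b y → 2 * y ≤ n →
                  ∃ λ L → 2 * a * L < n + a * a × DistLe n a (vertex b) (vertex (b + y)) L
    DistLe-half b y 2y≤n with y % a | y / a | m≡m%n+[m/n]*n y a | m%n<n y a
    ... | s | q | refl | s<a with 2 * s ≤? a
    ...   | yes 2s≤a = q + s , digits-bound q s refl 2y≤n 2s≤a (>-nonZero⁻¹ a) , DistLe-digits b q s
    ...   | no 2s≰a = suc q + t , overshoot-bound q t y+t≡ 2y≤n 2t<a , DistLe-digits-overshoot b q s t s+t≡a
      where
      t : ℕ
      t = a ∸ s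
      s+t≡a : s + t ≡ a
      s+t≡a = m+[n∸m]≡n (<⇒≤ s<a)
      y+t≡ : s + q * a + t ≡ suc q * a
      y+t≡ = begin
        s + q * a + t   ≡⟨ shuffle s (q * a) t ⟩
        s + t + q * a   ≡⟨ cong (_+ q * a) s+t≡a ⟩
        a + q * a       ∎
        where
        open ≡-Reasoning
        shuffle : ∀ s x t → s + x + t ≡ s + t + x
        shuffle = solve-∀
      2t<a : 2 * t < a
      2t<a = +-cancelˡ-< (2 * s) _ _ (begin-strict
        2 * s + 2 * t ≡⟨ *-distribˡ-+ 2 s t ⟨
        2 * (s + t)   ≡⟨ cong (2 *_) s+t≡a ⟩
        a + (a + 0)   <⟨ +-monoˡ-< (a + 0) (≰⇒> 2s≰a) ⟩
        2 * s + (a + 0) ≡⟨ cong (2 * s +_) (+-identityʳ a) ⟩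
        2 * s + a     ∎)
        where open ≤-Reasoning

    DistLe-bounded-ordered : .{{_ : NonZero a}} → ∀ u w → toℕ u ≤ toℕ w →
                             ∃ λ L → 2 * a * L < n + a * a × DistLe n a u w L
    DistLe-bounded-ordered u w u≤w with 2 * (toℕ w ∸ toℕ u) ≤? n
    ... | yes 2y≤n = map₂ (map₂ (subst₂ (λ p q → DistLe n a p q _) (vertex-toℕ u) u+y≡w))
                          (DistLe-half (toℕ u) (toℕ w ∸ toℕ u) 2y≤n)
      where
      u+y≡w : vertex (toℕ u + (toℕ w ∸ toℕ u)) ≡ w
      u+y≡w = trans (cong vertex (m+[n∸m]≡n u≤w)) (vertex-toℕ w)
    ... | no 2y≰n = map₂ (map₂ (DistLe-sym ∘ subst₂ (λ p q → DistLe n a p q _) (vertex-toℕ w) w+[n∸y]≡u))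
                         (DistLe-half (toℕ w) (n ∸ y) (half-complement y≤n 2y≰n))
      where
      y : ℕ
      y = toℕ w ∸ toℕ u
      y≤n : y ≤ n
      y≤n = ≤-trans (m∸n≤m (toℕ w) (toℕ u)) (<⇒≤ (Fin.toℕ<n w))
      w+[n∸y]≡u : vertex (toℕ w + (n ∸ y)) ≡ u
      w+[n∸y]≡u = begin
        vertex (toℕ w + (n ∸ y))       ≡⟨ cong (λ x → vertex (x + (n ∸ y))) (m+[n∸m]≡n u≤w) ⟨
        vertex (toℕ u + y + (n ∸ y))   ≡⟨ cong vertex (+-assoc (toℕ u) y (n ∸ y)) ⟩
        vertex (toℕ u + (y + (n ∸ y))) ≡⟨ cong (λ x → vertex (toℕ u + x)) (m+[n∸m]≡n y≤n) ⟩
        vertex (toℕ u + n)             ≡⟨ vertex-+n (toℕ u) ⟩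
        vertex (toℕ u)                 ≡⟨ vertex-toℕ u ⟩
        u                              ∎
        where open ≡-Reasoning

    DistLe-bounded : .{{_ : NonZero a}} → ∀ u w →
                     ∃ λ L → 2 * a * L < n + a * a × DistLe n a u w L
    DistLe-bounded u w with ≤-total (toℕ u) (toℕ w)
    ... | inj₁ u≤w = DistLe-bounded-ordered u w u≤w
    ... | inj₂ w≤u with DistLe-bounded-ordered w u w≤u
    ...   | L , bound , d = L , bound , DistLe-sym d

  DistLe-a-step : a ≤ n → ∀ b x → DistLe n a (vertex (b + x)) (vertex (b + (x + a))) 1
  DistLe-a-step a≤n b x = subst (λ m → DistLe n a (vertex (b + x)) (vertex m) 1) (+-assoc b x a)
    (Adj⇒DistLe (Adj-+a a≤n (b + x)))

  packing-from-offsets : ∀ v {k} r (offset : Slot r → ℕ) c M →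
    1 ≤ a → M + a < n → c ≤ n → (∀ i → offset i ≤ M) →
    (∀ i j → Near a (offset i) (offset j) → i ≡ j) →
    (∀ b i → DistLe n a (vertex (b + c)) (vertex (b + offset i)) r) →
    r + r + 1 ≤ k → k ≤ r + r + 2 → Packing n a v k
  packing-from-offsets v r offset c M 1≤a M+a<n c≤n offset≤M separated near lower upper = record
    { radius = r
    ; radius-lower = lower
    ; radius-upper = upper
    ; point = λ j → vertex (b + offset (slot r j))
    ; point-near = λ j → subst (λ u → DistLe n a u (vertex (b + offset (slot r j))) r) b+c≡v (near b (slot r j))
    ; point-separated = λ i j d → slot-injective r (separated _ _
        (DistLe1⇒Near b 1≤a M+a<n (offset≤M (slot r i)) (offset≤M (slot r j)) d))
    }
    where
    b : ℕ
    b = toℕ v + n ∸ c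
    b+c≡v : vertex (b + c) ≡ v
    b+c≡v = trans (cong vertex (m∸n+n≡m (≤-trans c≤n (m≤n+m n (toℕ v)))))
                  (trans (vertex-+n (toℕ v)) (vertex-toℕ v))

-- Packings

-- For a = f + 2r + 1: the offsets f+2, f+4, …, a+1, then a+f+3, …, 2a, and 0, all within
-- distance r of 2 + f + r.
module OffsetsR (f r : ℕ) where

  offset : Slot r → ℕ
  offset (inj₁ p) = 2 + f + 2 * toℕ p
  offset (inj₂ (inj₁ q)) = 4 + 2 * f + 2 * r + 2 * toℕ q
  offset (inj₂ (inj₂ _)) = 0

  private
    2r<a : 2 * r < f + 2 * r + 1
    2r<a = ≤-trans (s≤s (m≤n+m (2 * r) f)) (≤-reflexive (+-comm 1 (f + 2 * r)))

    even<a : ∀ {x} → x ≤ r → 2 * x < f + 2 * r + 1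
    even<a x≤r = ≤-<-trans (*-monoʳ-≤ 2 x≤r) 2r<a

    2x+a≢2y : ∀ x {y} → y ≤ r → 2 * x + (f + 2 * r + 1) ≢ 2 * y
    2x+a≢2y x y≤r = x+a≢y<a {x = 2 * x} (even<a y≤r)

    first-second : ∀ p q → p ≤ r → ¬ Near (f + 2 * r + 1) (2 + f + 2 * p) (4 + 2 * f + 2 * r + 2 * q)
    first-second p q p≤r near with r∸p ← r ∸ p | refl ← m+[n∸m]≡n p≤r =
      parity-clash (sym (Near-far x+2≤y near)) (2 + 2 * f + 2 * p + 2 * r∸p) (1 + q) p
        (solve (f ∷ p ∷ r∸p ∷ q ∷ [])) (solve (f ∷ p ∷ r∸p ∷ []))
      where
      x+2≤y : 2 + f + 2 * p + 2 ≤ 4 + 2 * f + 2 * (p + r∸p) + 2 * q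
      x+2≤y = ≤-by-excess (f + 2 * r∸p + 2 * q) (solve (f ∷ p ∷ r∸p ∷ q ∷ []))

    first-zero : ∀ p → ¬ Near (f + 2 * r + 1) 0 (2 + f + 2 * p)
    first-zero p near = parity-clash (sym (Near-far (s≤s (s≤s z≤n)) near)) f (1 + p) r
      (solve (f ∷ p ∷ [])) (solve (f ∷ r ∷ []))

    second-zero : ∀ q → ¬ Near (f + 2 * r + 1) 0 (4 + 2 * f + 2 * r + 2 * q)
    second-zero q near = excess-clash (sym (Near-far (s≤s (s≤s z≤n)) near)) (f + 2 * r + 1) (2 + f + 2 * q)
      (solve (f ∷ r ∷ q ∷ [])) refl

  offset-separated : ∀ i j → Near (f + 2 * r + 1) (offset i) (offset j) → i ≡ j
  offset-separated (inj₁ p) (inj₁ p′) near = cong inj₁ (Fin.toℕ-injective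
    (Near-progression (2 + f) 1 (2x+a≢2y (toℕ p) (toℕ≤pred[n] p′))
                                (2x+a≢2y (toℕ p′) (toℕ≤pred[n] p)) near))
  offset-separated (inj₂ (inj₁ q)) (inj₂ (inj₁ q′)) near = cong (inj₂ ∘ inj₁) (Fin.toℕ-injective
    (Near-progression (4 + 2 * f + 2 * r) 1 (2x+a≢2y (toℕ q) (<⇒≤ (Fin.toℕ<n q′)))
                                             (2x+a≢2y (toℕ q′) (<⇒≤ (Fin.toℕ<n q))) near))
  offset-separated (inj₂ (inj₂ zero)) (inj₂ (inj₂ zero)) near = refl
  offset-separated (inj₁ p) (inj₂ (inj₁ q)) near = ⊥-elim (first-second (toℕ p) (toℕ q) (toℕ≤pred[n] p) near)
  offset-separated (inj₂ (inj₁ q)) (inj₁ p) near =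
    ⊥-elim (first-second (toℕ p) (toℕ q) (toℕ≤pred[n] p) (Near-sym near))
  offset-separated (inj₁ p) (inj₂ (inj₂ _)) near = ⊥-elim (first-zero (toℕ p) (Near-sym near))
  offset-separated (inj₂ (inj₂ _)) (inj₁ p) near = ⊥-elim (first-zero (toℕ p) near)
  offset-separated (inj₂ (inj₁ q)) (inj₂ (inj₂ _)) near = ⊥-elim (second-zero (toℕ q) (Near-sym near))
  offset-separated (inj₂ (inj₂ _)) (inj₂ (inj₁ q)) near = ⊥-elim (second-zero (toℕ q) near)

-- For a = 3 + g: in base a the offsets have digits (0, 2p), (1, 2q + 1) and (a - 1, 2r), and lie
-- within distance r + 1 of (r + 1)a.
module OffsetsC (g r : ℕ) where

  offset : Slot (suc r) → ℕ
  offset (inj₁ p) = 2 * (3 + g) * toℕ p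
  offset (inj₂ (inj₁ q)) = 4 + g + 2 * (3 + g) * toℕ q
  offset (inj₂ (inj₂ _)) = 2 * (3 + g) * r + g + 2

  private
    odd-multiple : ∀ p q → 2 * (3 + g) * p + (3 + g) ≢ 2 * (3 + g) * q
    odd-multiple p q e = even≢odd q p (*-cancelˡ-≡ (2 * q) (suc (2 * p)) (3 + g) (begin
      (3 + g) * (2 * q)         ≡⟨ solve (g ∷ q ∷ []) ⟩
      2 * (3 + g) * q           ≡⟨ e ⟨
      2 * (3 + g) * p + (3 + g) ≡⟨ solve (g ∷ p ∷ []) ⟩
      (3 + g) * suc (2 * p)     ∎))
      where open ≡-Reasoning

    first-second : ∀ p q → ¬ Near (3 + g) (2 * (3 + g) * p) (4 + g + 2 * (3 + g) * q)
    first-second p q near with p ≤? q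
    ... | yes p≤q with d ← q ∸ p | refl ← m+[n∸m]≡n p≤q =
      excess-clash (sym (Near-far x+2≤y near)) (2 * (3 + g) * p + (3 + g)) (2 * (3 + g) * d)
        (solve (g ∷ p ∷ d ∷ [])) refl
      where
      x+2≤y : 2 * (3 + g) * p + 2 ≤ 4 + g + 2 * (3 + g) * (p + d)
      x+2≤y = ≤-by-excess (2 + g + 2 * (3 + g) * d) (solve (g ∷ p ∷ d ∷ []))
    ... | no p≰q with d ← p ∸ suc q | refl ← m+[n∸m]≡n (≰⇒> p≰q) =
      parity-clash (sym (Near-far y+2≤x (Near-sym near))) (2 * (3 + g) * q + 2 * (3 + g)) ((3 + g) * d) 0
        (solve (g ∷ q ∷ d ∷ [])) (solve (g ∷ q ∷ []))
      where
      y+2≤x : 4 + g + 2 * (3 + g) * q + 2 ≤ 2 * (3 + g) * (suc q + d)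
      y+2≤x = ≤-by-excess (g + 2 * (3 + g) * d) (solve (g ∷ q ∷ d ∷ []))

    first-third : ∀ p → p ≤ suc r → ¬ Near (3 + g) (2 * (3 + g) * p) (2 * (3 + g) * r + g + 2)
    first-third p p≤1+r near with m≤n⇒m<n∨m≡n p≤1+r
    ... | inj₁ p<1+r with d ← r ∸ p | refl ← m+[n∸m]≡n (s≤s⁻¹ p<1+r) =
      parity-clash (sym (Near-far x+2≤z near)) (2 * (3 + g) * p + g + 2) ((3 + g) * d) 0
        (solve (g ∷ p ∷ d ∷ [])) (solve (g ∷ p ∷ []))
      where
      x+2≤z : 2 * (3 + g) * p + 2 ≤ 2 * (3 + g) * (p + d) + g + 2
      x+2≤z = ≤-by-excess (2 * (3 + g) * d + g) (solve (g ∷ p ∷ d ∷ []))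
    ... | inj₂ refl =
      excess-clash (sym (Near-far z+2≤x (Near-sym near))) (2 * (3 + g) * r + g + 2 + (3 + g)) 0
        (solve (g ∷ r ∷ [])) refl
      where
      z+2≤x : 2 * (3 + g) * r + g + 2 + 2 ≤ 2 * (3 + g) * suc r
      z+2≤x = ≤-by-excess (2 + g) (solve (g ∷ r ∷ []))

    second-third : ∀ q → q ≤ r → ¬ Near (3 + g) (4 + g + 2 * (3 + g) * q) (2 * (3 + g) * r + g + 2)
    second-third q q≤r near with m≤n⇒m<n∨m≡n q≤r
    ... | inj₁ q<r with d ← r ∸ suc q | refl ← m+[n∸m]≡n q<r =
      excess-clash (sym (Near-far y+2≤z near)) (4 + g + 2 * (3 + g) * q + (3 + g)) (g + 2 * (3 + g) * d)
        (solve (g ∷ q ∷ d ∷ [])) refl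
      where
      y+2≤z : 4 + g + 2 * (3 + g) * q + 2 ≤ 2 * (3 + g) * (suc q + d) + g + 2
      y+2≤z = ≤-by-excess (2 + 2 * g + 2 * (3 + g) * d) (solve (g ∷ q ∷ d ∷ []))
    ... | inj₂ refl =
      excess-clash (Near-far z+2≤y (Near-sym near)) (4 + g + 2 * (3 + g) * q) g
        (solve (g ∷ q ∷ [])) refl
      where
      z+2≤y : 2 * (3 + g) * q + g + 2 + 2 ≤ 4 + g + 2 * (3 + g) * q
      z+2≤y = ≤-reflexive (solve (g ∷ q ∷ []))

  offset-separated : ∀ i j → Near (3 + g) (offset i) (offset j) → i ≡ j
  offset-separated (inj₁ p) (inj₁ p′) near = cong inj₁ (Fin.toℕ-injective
    (Near-progression 0 (3 + g) (odd-multiple (toℕ p) (toℕ p′)) (odd-multiple (toℕ p′) (toℕ p)) near))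
  offset-separated (inj₂ (inj₁ q)) (inj₂ (inj₁ q′)) near = cong (inj₂ ∘ inj₁) (Fin.toℕ-injective
    (Near-progression (4 + g) (3 + g) (odd-multiple (toℕ q) (toℕ q′)) (odd-multiple (toℕ q′) (toℕ q)) near))
  offset-separated (inj₂ (inj₂ zero)) (inj₂ (inj₂ zero)) near = refl
  offset-separated (inj₁ p) (inj₂ (inj₁ q)) near = ⊥-elim (first-second (toℕ p) (toℕ q) near)
  offset-separated (inj₂ (inj₁ q)) (inj₁ p) near = ⊥-elim (first-second (toℕ p) (toℕ q) (Near-sym near))
  offset-separated (inj₁ p) (inj₂ (inj₂ _)) near = ⊥-elim (first-third (toℕ p) (toℕ≤pred[n] p) near)
  offset-separated (inj₂ (inj₂ _)) (inj₁ p) near =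
    ⊥-elim (first-third (toℕ p) (toℕ≤pred[n] p) (Near-sym near))
  offset-separated (inj₂ (inj₁ q)) (inj₂ (inj₂ _)) near = ⊥-elim (second-third (toℕ q) (toℕ≤pred[n] q) near)
  offset-separated (inj₂ (inj₂ _)) (inj₂ (inj₁ q)) near =
    ⊥-elim (second-third (toℕ q) (toℕ≤pred[n] q) (Near-sym near))

module _ (n : ℕ) .{{_ : NonZero n}} where

  packingR : ∀ f r → 1 ≤ r → 3 * (f + 2 * r + 1) < n →
             ∀ v {k} → r + r + 1 ≤ k → k ≤ r + r + 2 → Packing n (f + 2 * r + 1) v k
  packingR f (suc r) _ 3a<n v = packing-from-offsets v (suc r) offset (2 + f + suc r)
    (2 * (f + 2 * suc r + 1)) (m≤n+m 1 (f + 2 * suc r)) 2a+a<n c≤n offset≤2a offset-separated near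
    where
    open Circulant n (f + 2 * suc r + 1)
    open OffsetsR f (suc r)

    2a+a<n : 2 * (f + 2 * suc r + 1) + (f + 2 * suc r + 1) < n
    2a+a<n = subst (_< n) (3*x≡2*x+x (f + 2 * suc r + 1)) 3a<n

    a≤n : f + 2 * suc r + 1 ≤ n
    a≤n = ≤-trans (m≤n+m (f + 2 * suc r + 1) (2 * (f + 2 * suc r + 1))) (<⇒≤ 2a+a<n)

    c≤n : 2 + f + suc r ≤ n
    c≤n = ≤-trans c≤a a≤n
      where
      c≤a : 2 + f + suc r ≤ f + 2 * suc r + 1
      c≤a = ≤-by-excess r (solve (f ∷ r ∷ []))

    offset≤2a : ∀ i → offset i ≤ 2 * (f + 2 * suc r + 1)
    offset≤2a (inj₁ p) = begin
      2 + f + 2 * toℕ p        ≤⟨ +-monoʳ-≤ (2 + f) (*-monoʳ-≤ 2 (toℕ≤pred[n] p)) ⟩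
      2 + f + 2 * suc r        ≤⟨ ≤-by-excess (f + 2 * suc r) (solve (f ∷ r ∷ [])) ⟩
      2 * (f + 2 * suc r + 1)  ∎
      where open ≤-Reasoning
    offset≤2a (inj₂ (inj₁ q)) = begin
      4 + 2 * f + 2 * suc r + 2 * toℕ q ≤⟨ +-monoʳ-≤ (4 + 2 * f + 2 * suc r) (*-monoʳ-≤ 2 (toℕ≤pred[n] q)) ⟩
      4 + 2 * f + 2 * suc r + 2 * r     ≡⟨ solve (f ∷ r ∷ []) ⟩
      2 * (f + 2 * suc r + 1)           ∎
      where open ≤-Reasoning
    offset≤2a (inj₂ (inj₂ _)) = z≤n

    near : ∀ b i → DistLe n (f + 2 * suc r + 1) (vertex (b + (2 + f + suc r))) (vertex (b + offset i)) (suc r)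
    near b (inj₁ p) = near-first (toℕ p) (toℕ≤pred[n] p)
      where
      near-first : ∀ p → p ≤ suc r →
        DistLe n (f + 2 * suc r + 1) (vertex (b + (2 + f + suc r))) (vertex (b + (2 + f + 2 * p))) (suc r)
      near-first p p≤r = DistLe-units b {2 + f + suc r} {2 + f + 2 * p} {suc r}
        (≤-by-excess (2 * p) (solve (f ∷ r ∷ p ∷ []))) (begin
        2 + f + 2 * p           ≤⟨ +-monoʳ-≤ (2 + f) (*-monoʳ-≤ 2 p≤r) ⟩
        2 + f + 2 * suc r       ≡⟨ solve (f ∷ r ∷ []) ⟩
        2 + f + suc r + suc r   ∎)
        where open ≤-Reasoning
    near b (inj₂ (inj₁ q)) = near-second (toℕ q) (toℕ≤pred[n] q)
      where
      near-second : ∀ q → q ≤ r → DistLe n (f + 2 * suc r + 1) (vertex (b + (2 + f + suc r)))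
                                        (vertex (b + (4 + 2 * f + 2 * suc r + 2 * q))) (suc r)
      near-second q q≤r = DistLe-trans (DistLe-a-step a≤n b (2 + f + suc r))
        (DistLe-units b {2 + f + suc r + (f + 2 * suc r + 1)} {4 + 2 * f + 2 * suc r + 2 * q} {r}
          (≤-by-excess (2 * q) (solve (f ∷ r ∷ q ∷ []))) (begin
          4 + 2 * f + 2 * suc r + 2 * q                ≤⟨ +-monoʳ-≤ (4 + 2 * f + 2 * suc r) (*-monoʳ-≤ 2 q≤r) ⟩
          4 + 2 * f + 2 * suc r + 2 * r                ≡⟨ solve (f ∷ r ∷ []) ⟩
          2 + f + suc r + (f + 2 * suc r + 1) + r      ∎))
        where open ≤-Reasoning
    near b (inj₂ (inj₂ _)) = subst (DistLe n _ _ _) (+-comm r 1)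
      (DistLe-trans (DistLe-units b {2 + f + suc r} {f + 2 * suc r + 1} {r} (≤-by-excess (2 * r) (solve (f ∷ r ∷ [])))
                                    (≤-reflexive (solve (f ∷ r ∷ []))))
                    (DistLe-sym (DistLe-a-step a≤n b 0)))

  packingC : ∀ g r → 2 * (3 + g) * suc r + (3 + g) < n →
             ∀ v {k} → suc r + suc r + 1 ≤ k → k ≤ suc r + suc r + 2 → Packing n (3 + g) v k
  packingC g r M+a<n v = packing-from-offsets v (suc r) offset (suc r * (3 + g)) (2 * (3 + g) * suc r)
    (s≤s z≤n) M+a<n c≤n offset≤M offset-separated near
    where
    open Circulant n (3 + g)
    open OffsetsC g r

    M≤n : 2 * (3 + g) * suc r ≤ n
    M≤n = ≤-trans (m≤m+n (2 * (3 + g) * suc r) (3 + g)) (<⇒≤ M+a<n)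

    a≤n : 3 + g ≤ n
    a≤n = ≤-trans (m≤n+m (3 + g) (2 * (3 + g) * suc r)) (<⇒≤ M+a<n)

    c≤n : suc r * (3 + g) ≤ n
    c≤n = ≤-trans c≤M M≤n
      where
      c≤M : suc r * (3 + g) ≤ 2 * (3 + g) * suc r
      c≤M = ≤-by-excess (suc r * (3 + g)) (solve (g ∷ r ∷ []))

    offset≤M : ∀ i → offset i ≤ 2 * (3 + g) * suc r
    offset≤M (inj₁ p) = *-monoʳ-≤ (2 * (3 + g)) (toℕ≤pred[n] p)
    offset≤M (inj₂ (inj₁ q)) = begin
      4 + g + 2 * (3 + g) * toℕ q ≤⟨ +-monoʳ-≤ (4 + g) (*-monoʳ-≤ (2 * (3 + g)) (toℕ≤pred[n] q)) ⟩
      4 + g + 2 * (3 + g) * r     ≤⟨ ≤-by-excess (2 + g) (solve (g ∷ r ∷ [])) ⟩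
      2 * (3 + g) * suc r         ∎
      where open ≤-Reasoning
    offset≤M (inj₂ (inj₂ _)) = ≤-by-excess {2 * (3 + g) * r + g + 2} (4 + g) (solve (g ∷ r ∷ []))

    near : ∀ b i → DistLe n (3 + g) (vertex (b + suc r * (3 + g))) (vertex (b + offset i)) (suc r)
    near b (inj₁ p) = near-first (toℕ p) (toℕ≤pred[n] p)
      where
      near-first : ∀ p → p ≤ suc r →
        DistLe n (3 + g) (vertex (b + suc r * (3 + g))) (vertex (b + 2 * (3 + g) * p)) (suc r)
      near-first p p≤1+r = subst (λ x → DistLe n (3 + g) (vertex (b + suc r * (3 + g))) (vertex (b + x)) (suc r))
        reorder (DistLe-multiples a≤n b {suc r} {2 * p} {suc r} (m≤n+m (suc r) (2 * p)) (begin
          2 * p         ≤⟨ *-monoʳ-≤ 2 p≤1+r ⟩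
          2 * suc r     ≡⟨ solve (r ∷ []) ⟩
          suc r + suc r ∎))
        where
        open ≤-Reasoning
        reorder : 2 * p * (3 + g) ≡ 2 * (3 + g) * p
        reorder = solve (g ∷ p ∷ [])
    near b (inj₂ (inj₁ q)) = near-second (toℕ q) (toℕ≤pred[n] q)
      where
      near-second : ∀ q → q ≤ r →
        DistLe n (3 + g) (vertex (b + suc r * (3 + g))) (vertex (b + (4 + g + 2 * (3 + g) * q))) (suc r)
      near-second q q≤r = DistLe-trans
        (DistLe-units b {suc r * (3 + g)} {suc r * (3 + g) + 1} {1} (≤-trans (m≤m+n _ 1) (m≤m+n _ 1)) ≤-refl)
        (subst₂ (λ x y → DistLe n (3 + g) (vertex x) (vertex y) r) start end
          (DistLe-multiples a≤n (b + 1) {suc r} {2 * q + 1} {r}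
            (≤-by-excess (2 * q) (solve (r ∷ q ∷ []))) 2q+1≤1+r+r))
        where
        start : b + 1 + suc r * (3 + g) ≡ b + (suc r * (3 + g) + 1)
        start = solve (b ∷ g ∷ r ∷ [])
        end : b + 1 + (2 * q + 1) * (3 + g) ≡ b + (4 + g + 2 * (3 + g) * q)
        end = solve (b ∷ g ∷ q ∷ [])
        2q+1≤1+r+r : 2 * q + 1 ≤ suc r + r
        2q+1≤1+r+r = begin
          2 * q + 1 ≤⟨ +-monoˡ-≤ 1 (*-monoʳ-≤ 2 q≤r) ⟩
          2 * r + 1 ≡⟨ solve (r ∷ []) ⟩
          suc r + r ∎
          where open ≤-Reasoning
    near b (inj₂ (inj₂ _)) = DistLe-trans
      (DistLe-sym (DistLe-units b {2 + g + r * (3 + g)} {suc r * (3 + g)} {1}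
        (≤-by-excess 2 (solve (g ∷ r ∷ []))) (≤-reflexive (solve (g ∷ r ∷ [])))))
      (subst₂ (λ x y → DistLe n (3 + g) (vertex x) (vertex y) r) start end
        (DistLe-multiples a≤n (b + (2 + g)) {r} {2 * r} {r} (m≤n+m r (2 * r)) (≤-reflexive (solve (r ∷ [])))))
      where
      start : b + (2 + g) + r * (3 + g) ≡ b + (2 + g + r * (3 + g))
      start = solve (b ∷ g ∷ r ∷ [])
      end : b + (2 + g) + 2 * r * (3 + g) ≡ b + (2 * (3 + g) * r + g + 2)
      end = solve (b ∷ g ∷ r ∷ [])

  packing : ∀ {a} v {k} → 3 ≤ a → 3 * a < n → 3 ≤ k → 2 * a * k < n + a * a → Packing n a v k
  packing {a} v {k} 3≤a 3a<n 3≤k 2ak<n+aa with radius-of k 3≤k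
  ... | r@(suc r′) , 1≤r , lower , upper with 2 * r + 1 ≤? a
  ...   | yes 2r+1≤a = subst (λ a → Packing n a v k) a≡f+2r+1
            (packingR f r 1≤r (subst (λ a → 3 * a < n) (sym a≡f+2r+1) 3a<n) v lower upper)
    where
    f : ℕ
    f = a ∸ (2 * r + 1)
    a≡f+2r+1 : f + 2 * r + 1 ≡ a
    a≡f+2r+1 = trans (+-assoc f (2 * r) 1) (m∸n+n≡m 2r+1≤a)
  ...   | no 2r+1≰a = subst (λ a → Packing n a v k) (m+[n∸m]≡n 3≤a)
            (packingC (a ∸ 3) r′ window v lower upper)
    where
    a≤r+r : a ≤ r + r
    a≤r+r = ≤-trans (s≤s⁻¹ (≰⇒> 2r+1≰a)) (≤-reflexive (solve (r′ ∷ [])))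
    window : 2 * (3 + (a ∸ 3)) * r + (3 + (a ∸ 3)) < n
    window = subst (λ a → 2 * a * r + a < n) (sym (m+[n∸m]≡n 3≤a))
      (window-from-eccentricity 2ak<n+aa a≤r+r lower)

-- Replacing large values

kept : ℕ → ℕ
kept 0 = 0
kept 1 = 1
kept 2 = 2
kept (suc (suc (suc _))) = 0

replaced : ℕ → ℕ
replaced 0 = 0
replaced 1 = 0
replaced 2 = 0
replaced k@(suc (suc (suc _))) = k

kept+replaced : ∀ k → kept k + replaced k ≡ k
kept+replaced 0 = refl
kept+replaced 1 = refl
kept+replaced 2 = refl
kept+replaced (suc (suc (suc _))) = refl

kept-positive : ∀ {k} → 0 < kept k → kept k ≡ k × k ≤ 2
kept-positive {1} _ = refl , s≤s z≤n
kept-positive {2} _ = refl , ≤-refl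

replaced-large : ∀ {k} → 3 ≤ k → replaced k ≡ k
replaced-large {1} (s≤s ())
replaced-large {2} (s≤s (s≤s ()))
replaced-large {suc (suc (suc _))} _ = refl

replaced-small : ∀ {k} → ¬ 3 ≤ k → replaced k ≡ 0
replaced-small {0} _ = refl
replaced-small {1} _ = refl
replaced-small {2} _ = refl
replaced-small {suc (suc (suc _))} 3≰k = ⊥-elim (3≰k (s≤s (s≤s (s≤s z≤n))))

module Replacement {n a : ℕ} .{{_ : NonZero n}} .{{_ : NonZero a}} (3≤a : 3 ≤ a) (3a<n : 3 * a < n)
                   {g : Fin n → ℕ} (g-indep : IsIndepBroadcast n a g) where

  private
    g-broadcast : IsBroadcast n a g
    g-broadcast = proj₁ g-indep

    g-independent : IsIndependent n a g
    g-independent = proj₂ g-indep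

    a≤n : a ≤ n
    a≤n = ≤-trans (m≤n+m a (2 * a)) (≤-trans (≤-reflexive (sym (3*x≡2*x+x a))) (<⇒≤ 3a<n))

  eccentricity-bound : ∀ v → 2 * a * g v < n + a * a
  eccentricity-bound v with g-broadcast v
  ... | w , far with Circulant.DistLe-bounded n a a≤n v w
  ...   | L , bound , d with g v ≤? L
  ...     | yes gv≤L = ≤-<-trans (*-monoʳ-≤ (2 * a) gv≤L) bound
  ...     | no gv≰L = ⊥-elim (far L (≰⇒> gv≰L) d)

  record Cluster (v : Fin n) : Set where
    field
      size : ℕ
      point : Fin size → Fin n
      radius : ℕ
      replaced≤size : replaced (g v) ≤ size
      point-near : ∀ j → DistLe n a v (point j) radius
      point-separated : ∀ i j → DistLe n a (point i) (point j) 1 → i ≡ j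
      nonempty⇒large : Fin size → 3 ≤ g v × radius + radius + 1 ≤ g v × g v ≤ radius + radius + 2

  cluster : ∀ v → Cluster v
  cluster v with 3 ≤? g v
  ... | yes 3≤gv = record
    { size = suc radius + (radius + 1)
    ; point = point
    ; radius = radius
    ; replaced≤size = subst (_≤ suc radius + (radius + 1)) (sym (replaced-large 3≤gv))
        (≤-trans radius-upper (≤-reflexive (r+r+2≡slots radius)))
    ; point-near = point-near
    ; point-separated = point-separated
    ; nonempty⇒large = λ _ → 3≤gv , radius-lower , radius-upper
    }
    where open Packing (packing n v 3≤a 3a<n 3≤gv (eccentricity-bound v))
  ... | no 3≰gv = record
    { size = 0
    ; point = λ ()
    ; radius = 0
    ; replaced≤size = ≤-reflexive (replaced-small 3≰gv)
    ; point-near = λ ()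
    ; point-separated = λ ()
    ; nonempty⇒large = λ ()
    }

  open Cluster

  size-of : Fin n → ℕ
  size-of v = size (cluster v)

  point-of : ∀ v → Fin (size-of v) → Fin n
  point-of v = point (cluster v)

  multiplicity : Fin n → ℕ
  multiplicity x = sum λ v → sum λ j → δ x (point-of v j)

  private
    positive : ∀ {k} → 3 ≤ k → 0 < k
    positive 3≤k = ≤-trans (s≤s z≤n) 3≤k

  multiplicity-positive : ∀ x → 0 < multiplicity x → ∃ λ v → ∃ λ j → point-of v j ≡ x
  multiplicity-positive x 0<m with sum-positive _ 0<m
  ... | v , 0<mv with sum-positive _ 0<mv
  ...   | j , 0<δ = v , j , sym (δ-positive x (point-of v j) 0<δ)

  clusters-apart : ∀ {v₁ v₂} j₁ j₂ → v₁ ≢ v₂ → ¬ DistLe n a (point-of v₁ j₁) (point-of v₂ j₂) 1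
  clusters-apart {v₁} {v₂} j₁ j₂ v₁≢v₂ d
    with nonempty⇒large (cluster v₁) j₁ | nonempty⇒large (cluster v₂) j₂
  ... | large₁ , lower₁ , upper₁ | large₂ , lower₂ , upper₂ =
    g-independent v₁ v₂ v₁≢v₂ (positive large₁) (positive large₂)
      (DistLe-mono (radii-within-max {radius (cluster v₁)} {radius (cluster v₂)} lower₁ upper₁ lower₂ upper₂)
        (DistLe-trans (DistLe-trans (point-near (cluster v₁) j₁) d) (DistLe-sym (point-near (cluster v₂) j₂))))

  kept-apart : ∀ {u v} j → 0 < kept (g u) → ¬ DistLe n a u (point-of v j) (g u)
  kept-apart {u} {v} j 0<kept d with nonempty⇒large (cluster v) j | kept-positive 0<kept
  ... | large , lower , upper | kept≡ , gu≤2 =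
    g-independent v u v≢u (positive large) (subst (0 <_) kept≡ 0<kept)
      (DistLe-mono bound (DistLe-trans (point-near (cluster v) j) (DistLe-sym d)))
    where
    v≢u : v ≢ u
    v≢u refl = <⇒≱ large gu≤2
    bound : radius (cluster v) + g u ≤ g v ⊔ g u
    bound = ≤-trans (+-monoʳ-≤ (radius (cluster v)) gu≤2)
                    (≤-trans (radius+2≤ large lower upper) (m≤m⊔n (g v) (g u)))

  multiplicity≤1 : ∀ x → multiplicity x ≤ 1
  multiplicity≤1 x = sum-≤1 _ within-cluster across-clusters
    where
    within-cluster : ∀ v → sum (λ j → δ x (point-of v j)) ≤ 1
    within-cluster v = sum-≤1 _ (λ j → δ≤1 x (point-of v j)) λ i j p q →
      point-separated (cluster v) i j (≡⇒DistLe (trans (sym (δ-positive x _ p)) (δ-positive x _ q)) 1)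
    across-clusters : ∀ v₁ v₂ → 0 < sum (λ j → δ x (point-of v₁ j)) →
                      0 < sum (λ j → δ x (point-of v₂ j)) → v₁ ≡ v₂
    across-clusters v₁ v₂ p q with v₁ Fin.≟ v₂ | sum-positive _ p | sum-positive _ q
    ... | yes v₁≡v₂ | _ | _ = v₁≡v₂
    ... | no v₁≢v₂ | j₁ , p₁ | j₂ , q₂ = ⊥-elim (clusters-apart j₁ j₂ v₁≢v₂
      (≡⇒DistLe (trans (sym (δ-positive x _ p₁)) (δ-positive x _ q₂)) 1))

  kept⇒unoccupied : ∀ x → 0 < kept (g x) → multiplicity x ≡ 0
  kept⇒unoccupied x 0<kept with multiplicity x in eq
  ... | zero = refl
  ... | suc _ with multiplicity-positive x (subst (0 <_) (sym eq) (s≤s z≤n))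
  ...   | v , j , point≡x = ⊥-elim (kept-apart j 0<kept (≡⇒DistLe (sym point≡x) (g x)))

  h : Fin n → ℕ
  h x = kept (g x) + multiplicity x

  kept⇒h≡g : ∀ {x} → 0 < kept (g x) → h x ≡ g x
  kept⇒h≡g {x} 0<kept = begin
    kept (g x) + multiplicity x ≡⟨ cong (kept (g x) +_) (kept⇒unoccupied x 0<kept) ⟩
    kept (g x) + 0              ≡⟨ +-identityʳ _ ⟩
    kept (g x)                  ≡⟨ proj₁ (kept-positive 0<kept) ⟩
    g x                         ∎
    where open ≡-Reasoning

  unkept⇒h≡multiplicity : ∀ {x} → ¬ 0 < kept (g x) → h x ≡ multiplicity x
  unkept⇒h≡multiplicity {x} 0≮kept = cong (_+ multiplicity x) (n≤0⇒n≡0 (≮⇒≥ 0≮kept))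

  data Source (x : Fin n) : Set where
    from-kept : 0 < kept (g x) → h x ≡ g x → Source x
    from-cluster : ∀ v j → point-of v j ≡ x → h x ≤ 1 → Source x

  source : ∀ x → 0 < h x → Source x
  source x 0<hx with 0 <? kept (g x)
  ... | yes 0<kept = from-kept 0<kept (kept⇒h≡g 0<kept)
  ... | no 0≮kept with multiplicity-positive x (subst (0 <_) (unkept⇒h≡multiplicity 0≮kept) 0<hx)
  ...   | v , j , point≡x = from-cluster v j point≡x
          (subst (_≤ 1) (sym (unkept⇒h≡multiplicity 0≮kept)) (multiplicity≤1 x))

  h-two-bounded : TwoBounded h
  h-two-bounded x with 0 <? kept (g x)
  ... | yes 0<kept = subst (_≤ 2) (sym (kept⇒h≡g 0<kept)) (proj₂ (kept-positive 0<kept))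
  ... | no 0≮kept = subst (_≤ 2) (sym (unkept⇒h≡multiplicity 0≮kept)) (≤-trans (multiplicity≤1 x) (n≤1+n 1))

  h-independent : IsIndependent n a h
  h-independent u w u≢w 0<hu 0<hw d with source u 0<hu | source w 0<hw
  ... | from-kept kept-u hu≡gu | from-kept kept-w hw≡gw =
    g-independent u w u≢w (subst (0 <_) hu≡gu 0<hu) (subst (0 <_) hw≡gw 0<hw)
      (subst₂ (λ x y → DistLe n a u w (x ⊔ y)) hu≡gu hw≡gw d)
  ... | from-kept kept-u hu≡gu | from-cluster v j refl hw≤1 =
    kept-apart j kept-u (DistLe-mono (⊔-lub (≤-reflexive hu≡gu) (≤-trans hw≤1 (subst (0 <_) hu≡gu 0<hu))) d)
  ... | from-cluster v j refl hu≤1 | from-kept kept-w hw≡gw =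
    kept-apart j kept-w
      (DistLe-sym (DistLe-mono (⊔-lub (≤-trans hu≤1 (subst (0 <_) hw≡gw 0<hw)) (≤-reflexive hw≡gw)) d))
  ... | from-cluster v₁ j₁ refl hu≤1 | from-cluster v₂ j₂ refl hw≤1 with v₁ Fin.≟ v₂
  ...   | no v₁≢v₂ = clusters-apart j₁ j₂ v₁≢v₂ (DistLe-mono (⊔-lub hu≤1 hw≤1) d)
  ...   | yes refl =
    u≢w (cong (point-of v₁) (point-separated (cluster v₁) j₁ j₂ (DistLe-mono (⊔-lub hu≤1 hw≤1) d)))

  other-vertex : (x : Fin n) → ∃ λ y → x ≢ y
  other-vertex x with toℕ x ≟ 0
  ... | yes x≡0 = fromℕ< 1<n ,
    λ x≡y → 0≢1+n (trans (sym x≡0) (trans (cong toℕ x≡y) (Fin.toℕ-fromℕ< 1<n)))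
    where
    1<n : 1 < n
    1<n = ≤-trans (s≤s (s≤s z≤n)) (≤-trans (m≤m*n 3 a) (<⇒≤ 3a<n))
  ... | no x≢0 = fromℕ< (>-nonZero⁻¹ n) , λ x≡y → x≢0 (trans (cong toℕ x≡y) (Fin.toℕ-fromℕ< _))

  h-broadcast : IsBroadcast n a h
  h-broadcast x with 0 <? kept (g x)
  ... | yes 0<kept = map₂ (λ far k k<hx → far k (subst (k <_) (kept⇒h≡g 0<kept) k<hx)) (g-broadcast x)
  ... | no 0≮kept = map₂ (λ x≢y k k<hx d → x≢y (DistLe0⇒≡ (DistLe-mono (k≤0 k k<hx) d))) (other-vertex x)
    where
    k≤0 : ∀ k → k < h x → k ≤ 0
    k≤0 k k<hx = s≤s⁻¹
      (≤-trans k<hx (subst (_≤ 1) (sym (unkept⇒h≡multiplicity 0≮kept)) (multiplicity≤1 x)))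

  sum-multiplicity : sum multiplicity ≡ sum size-of
  sum-multiplicity = begin
    sum (λ x → sum λ v → sum λ j → δ x (point-of v j)) ≡⟨ ∑-comm (λ x v → sum λ j → δ x (point-of v j)) ⟩
    sum (λ v → sum λ x → sum λ j → δ x (point-of v j)) ≡⟨ sum-cong-≗ (λ v → ∑-comm (λ x j → δ x (point-of v j))) ⟩
    sum (λ v → sum λ j → sum λ x → δ x (point-of v j)) ≡⟨ sum-cong-≗ points-counted ⟩
    sum size-of                                         ∎
    where
    open ≡-Reasoning
    points-counted : ∀ v → sum (λ j → sum λ x → δ x (point-of v j)) ≡ size-of v
    points-counted v = trans (sum-cong-≗ (λ j → sum-δ (point-of v j))) (sum-one (size-of v))

  cost≤cost-h : cost g ≤ cost h
  cost≤cost-h = begin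
    cost g                                  ≡⟨ cost≡sum g ⟩
    sum g                                   ≡⟨ sum-cong-≗ (λ x → kept+replaced (g x)) ⟨
    sum (λ x → kept (g x) + replaced (g x)) ≡⟨ ∑-distrib-+ (kept ∘ g) (replaced ∘ g) ⟩
    sum (kept ∘ g) + sum (replaced ∘ g)     ≤⟨ +-monoʳ-≤ (sum (kept ∘ g)) (sum-mono-≤ (λ v → replaced≤size (cluster v))) ⟩
    sum (kept ∘ g) + sum size-of            ≡⟨ cong (sum (kept ∘ g) +_) sum-multiplicity ⟨
    sum (kept ∘ g) + sum multiplicity       ≡⟨ ∑-distrib-+ (kept ∘ g) multiplicity ⟨
    sum h                                   ≡⟨ cost≡sum h ⟨
    cost h                                  ∎
    where open ≤-Reasoning

-- A maximum 2-bounded broadcast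

module Decidable (n a : ℕ) where

  StepBy? : ∀ s u v → Dec (StepBy n s u v)
  StepBy? s u v = (toℕ u + s ≟ toℕ v) ⊎-dec (toℕ u + s ≟ toℕ v + n)

  Adj? : ∀ u v → Dec (Adj n a u v)
  Adj? u v = StepBy? 1 u v ⊎-dec (StepBy? 1 v u ⊎-dec (StepBy? a u v ⊎-dec StepBy? a v u))

  Walk? : ∀ j u v → Dec (Walk n a u v j)
  Walk? zero u v = map′ (λ { refl → here }) (λ { here → refl }) (u Fin.≟ v)
  Walk? (suc j) u v = map′ (λ (w , e , p) → step e p) (λ { (step e p) → _ , e , p })
    (Fin.any? λ w → Adj? u w ×-dec Walk? j w v)

  DistLe? : ∀ u v k → Dec (DistLe n a u v k)
  DistLe? u v k = map′ (λ (j , j<1+k , p) → j , s≤s⁻¹ j<1+k , p) (λ (j , j≤k , p) → j , s≤s j≤k , p)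
    (anyUpTo? (λ j → Walk? j u v) (suc k))

  IsIndepBroadcast? : ∀ f → Dec (IsIndepBroadcast n a f)
  IsIndepBroadcast? f = broadcast? ×-dec independent?
    where
    broadcast? = Fin.all? λ v → Fin.any? λ w →
      map′ (λ far k → far {k}) (λ far {k} → far k) (allUpTo? (λ k → ¬? (DistLe? v w k)) (f v))
    independent? = Fin.all? λ u → Fin.all? λ v →
      ¬? (u Fin.≟ v) →-dec (0 <? f u →-dec (0 <? f v →-dec ¬? (DistLe? u v (f u ⊔ f v))))

two-bounded-functions : ∀ n → List (Fin n → ℕ)
two-bounded-functions zero = (λ ()) ∷ []
two-bounded-functions (suc n) =
  map (0 Vector.∷_) (two-bounded-functions n) ++
  map (1 Vector.∷_) (two-bounded-functions n) ++
  map (2 Vector.∷_) (two-bounded-functions n)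

two-bounded-functions-complete : ∀ {n} (f : Fin n → ℕ) → TwoBounded f →
                                 Any (_≗ f) (two-bounded-functions n)
two-bounded-functions-complete {zero} f _ = here (λ ())
two-bounded-functions-complete {suc n} f f≤2 = by-head (f zero) refl (f≤2 zero)
  where
  with-head : ∀ c → c ≡ f zero → Any (_≗ f) (map (c Vector.∷_) (two-bounded-functions n))
  with-head c c≡f0 = Any.gmap (λ t≗f∘suc → λ { zero → c≡f0 ; (suc i) → t≗f∘suc i })
                              (two-bounded-functions-complete (f ∘ suc) (f≤2 ∘ suc))
  by-head : ∀ c → c ≡ f zero → c ≤ 2 → Any (_≗ f) (two-bounded-functions (suc n))
  by-head 0 e _ = Any.++⁺ˡ (with-head 0 e)
  by-head 1 e _ = Any.++⁺ʳ (map (0 Vector.∷_) (two-bounded-functions n)) (Any.++⁺ˡ (with-head 1 e))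
  by-head 2 e _ = Any.++⁺ʳ (map (0 Vector.∷_) (two-bounded-functions n))
                    (Any.++⁺ʳ (map (1 Vector.∷_) (two-bounded-functions n)) (with-head 2 e))
  by-head (suc (suc (suc _))) _ (s≤s (s≤s ()))

module TwoBoundedMaximum (n a : ℕ) where

  Candidate : (Fin n → ℕ) → Set
  Candidate f = TwoBounded f × IsIndepBroadcast n a f

  candidate? : ∀ f → Dec (Candidate f)
  candidate? f = Fin.all? (λ v → f v ≤? 2) ×-dec Decidable.IsIndepBroadcast? n a f

  Candidate-resp : ∀ {f f′} → f ≗ f′ → Candidate f → Candidate f′
  Candidate-resp {f} {f′} f≗f′ (two-bounded , broadcast , independent) =
    (λ v → subst (_≤ 2) (f≗f′ v) (two-bounded v)) ,
    (λ v → map₂ (λ far k k<f′v → far k (subst (k <_) (sym (f≗f′ v)) k<f′v)) (broadcast v)) ,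
    (λ u v u≢v 0<f′u 0<f′v d → independent u v u≢v (subst (0 <_) (sym (f≗f′ u)) 0<f′u)
       (subst (0 <_) (sym (f≗f′ v)) 0<f′v)
       (subst₂ (λ x y → DistLe n a u v (x ⊔ y)) (sym (f≗f′ u)) (sym (f≗f′ v)) d))

  zero-candidate : Candidate (λ _ → 0)
  zero-candidate = (λ _ → z≤n) , (λ v → v , λ _ ()) , (λ _ _ _ ())

  candidates : List (Fin n → ℕ)
  candidates = filter candidate? (two-bounded-functions n)

  best : Fin n → ℕ
  best = argmax cost (λ _ → 0) candidates

  best-candidate : Candidate best
  best-candidate = argmax-all cost zero-candidate (all-filter candidate? (two-bounded-functions n))

  best-maximal : ∀ f → Candidate f → cost f ≤ cost best
  best-maximal f candidate-f with find (two-bounded-functions-complete f (proj₁ candidate-f))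
  ... | f′ , f′∈ , f′≗f = begin
    cost f    ≡⟨ cost-cong f′≗f ⟨
    cost f′   ≤⟨ All.lookup (f[xs]≤f[argmax] (λ _ → 0) candidates)
                   (∈-filter⁺ candidate? f′∈ (Candidate-resp (sym ∘ f′≗f) candidate-f)) ⟩
    cost best ∎
    where open ≤-Reasoning

  β-broadcast-of-dominated : (∀ g → IsIndepBroadcast n a g → ∃ λ f → Candidate f × cost g ≤ cost f) →
                             ∃ λ f → TwoBounded f × IsBetaBroadcast n a f
  β-broadcast-of-dominated dominated = best , proj₁ best-candidate , proj₂ best-candidate ,
    λ g g-indep → let f , candidate-f , g≤f = dominated g g-indep in ≤-trans g≤f (best-maximal f candidate-f)

lemma8 : (n a : ℕ) → 3 ≤ a → a ≤ n / 2 → 3 * a < n →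
    ∃ λ (f : Fin n → ℕ) → TwoBounded f × IsBetaBroadcast n a f
lemma8 zero _ _ _ ()
lemma8 (suc _) zero () _ _
-- The hypothesis a ≤ n / 2 is implied by 3a < n.
lemma8 n@(suc _) a@(suc _) 3≤a _ 3a<n = TwoBoundedMaximum.β-broadcast-of-dominated n a dominated
  where
  dominated : ∀ g → IsIndepBroadcast n a g →
              ∃ λ f → (TwoBounded f × IsIndepBroadcast n a f) × cost g ≤ cost f
  dominated g g-indep = h , (h-two-bounded , h-broadcast , h-independent) , cost≤cost-h
    where open Replacement 3≤a 3a<n g-indep
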